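{- Let $n,\alpha$ be integers with $1\le\alpha\le n$. Then $f_{\sf T}(n,\alpha)=n+1$ if $\alpha=1$; $f_{\sf T}(n,\alpha)=2^n$ if $\alpha=n$; and \[ f_{\sf T}(n,\alpha)=f_{\sf T}(n-1,\alpha)+f_{\sf T}\!\left(n-\left\lceil\tfrac{n}{\alpha}\right\rceil,\alpha-1\right)\quad\text{if } 2\le\alpha\le n-1. \]
   Context: For integers $1\le\alpha\le n$, $T_{n,\alpha}$ is the disjoint union of $\alpha$ cliques whose orders sum to $n$ and differ pairwise by at most one, and $f_{\sf T}(n,\alpha)$ is the number of stable sets (including the empty set) of $T_{n,\alpha}$. -}

module Defs where

open import Data.Nat using (ℕ; zero; suc; _+_; _/_; _%_)
open import Data.Nat.Properties using (_≟_)
open import Data.Fin using (Fin; toℕ)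
open import Data.Fin.Properties using (all?) renaming (_≟_ to _≟ᶠ_)
open import Data.Fin.Subset using (Subset; _∈_; inside; outside)
open import Data.Fin.Subset.Properties using (_∈?_)
open import Data.Vec using ([]; _∷_)
open import Data.List using (List; []; _∷_; map; _++_; filter; length)
open import Data.Product using (_×_)
open import Relation.Nullary using (¬_; Dec; ¬?)
open import Relation.Nullary.Decidable using (_×-dec_; _→-dec_)
open import Relation.Binary.PropositionalEquality using (_≡_; _≢_)

-- ⌈ n / α ⌉ for α ≥ 1 (the value at α = 0 is an irrelevant convention).
ceilDiv : ℕ → ℕ → ℕ
ceilDiv n zero    = 0
ceilDiv n (suc k) = (n + k) / suc k

-- Concrete model of T_{n,α}: vertex set Fin n, vertex v lies in clique
-- number (v mod α).  For 1 ≤ α ≤ n this gives α nonempty cliques whose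
-- orders are ⌊n/α⌋ or ⌈n/α⌉, i.e. sum to n and differ by at most one.
-- (The convention at α = 0 is irrelevant to the statement.)
cliqueOf : (α : ℕ) → ℕ → ℕ
cliqueOf zero    v = v
cliqueOf (suc k) v = v % suc k

Adj : (n α : ℕ) → Fin n → Fin n → Set
Adj n α u v = (u ≢ v) × (cliqueOf α (toℕ u) ≡ cliqueOf α (toℕ v))

adj? : (n α : ℕ) → (u v : Fin n) → Dec (Adj n α u v)
adj? n α u v = ¬? (u ≟ᶠ v) ×-dec (cliqueOf α (toℕ u) ≟ cliqueOf α (toℕ v))

IsStable : (n α : ℕ) → Subset n → Set
IsStable n α S = ∀ u v → u ∈ S → v ∈ S → ¬ Adj n α u v

stable? : (n α : ℕ) → (S : Subset n) → Dec (IsStable n α S)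
stable? n α S = all? λ u → all? λ v → (u ∈? S) →-dec ((v ∈? S) →-dec ¬? (adj? n α u v))

allSubsets : (n : ℕ) → List (Subset n)
allSubsets zero    = [] ∷ []
allSubsets (suc n) = map (inside ∷_) (allSubsets n) ++ map (outside ∷_) (allSubsets n)

-- f_T(n, α) = number of stable sets (including ∅) of T_{n,α}
fT : ℕ → ℕ → ℕ
fT n α = length (filter (stable? n α) (allSubsets n))

-- Colour vertex v of T_{n,α} by its clique, v mod α.  A vertex set is stable
-- exactly when it meets every colour class at most once, so
--   f_T(n,α) = ∏_{x<α} (1 + c_x),   c_x = size of the colour class x.
-- To prove this one vertex at a time we count, for an ARBITRARY colouring
-- c : Fin n → ℕ and a set F of forbidden colours, the colourful vertex sets
-- (c injective on S, no colour of S in F): their number is ∏_{x<α} w_x with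
-- w_x = 1 for x ∈ F and w_x = 1 + c_x otherwise (colourful-product).  Peeling
-- off vertex 0 of colour l either drops it, or keeps it and forbids l.
-- For the residue colouring and n = r + qα with r ≤ α the class sizes are
-- c_x = q + [x < r] (residue-classSize), giving the closed form
--   f_T(r + qα, α) = (q+2)^r (q+1)^(α-r)                     (fT-closed-form).
-- The three claims of the theorem are arithmetic consequences of it: α = 1 is
-- r = 0, q = n; α = n is r = α, q = 0; and for the recurrence one writes
-- n - 1 = r + qα with r < α, so that ⌈n/α⌉ = q + 1 and n - ⌈n/α⌉ = r + q(α-1).
module Submission where

open import Defs
open import Level using (0ℓ)
open import Data.Bool using (Bool; true; false) renaming (_≟_ to _≟ᵇ_)
open import Data.Empty using (⊥-elim)
open import Data.Fin using (Fin; toℕ) renaming (zero to fz; suc to fs)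
open import Data.Fin.Properties using (all?) renaming (_≟_ to _≟ᶠ_; suc-injective to fs-injective)
open import Data.Fin.Subset using (Subset; _∈_; inside; outside)
open import Data.Fin.Subset.Properties using (_∈?_)
open import Data.List using (List; []; _∷_; _++_; map; filter; length)
open import Data.List.Properties using (filter-++; length-++; length-map; filter-≐; filter-none)
open import Data.List.Relation.Unary.All using (universal)
open import Data.Nat using (ℕ; zero; suc; _+_; _*_; _∸_; _^_; _≤_; _<_; s≤s; z≤n; _%_; _/_; _<?_)
open import Data.Nat.Properties
open import Data.Nat.DivMod using (m%n<n; m<n⇒m%n≡m; [m+kn]%n≡m%n; m≡m%n+[m/n]*n; +-distrib-/-∣ʳ; m<n⇒m/n≡0; m*n/n≡m)
open import Data.Nat.Divisibility using (n∣m*n)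
open import Data.Nat.Solver using (module +-*-Solver)
open import Data.Product using (_×_; _,_)
open import Data.Vec using (_∷_; here; there)
open import Function using (_∘_)
open import Relation.Nullary using (¬_; Dec; yes; no; does; ¬?)
open import Relation.Nullary.Decidable using (_×-dec_; _→-dec_)
open import Relation.Unary using (Pred; Decidable; _≐_)
open import Relation.Binary.PropositionalEquality
open import Relation.Binary.Definitions using (tri<; tri≈; tri>)
open +-*-Solver using (solve; _:=_; _:+_; _:*_; con)
open ≡-Reasoning

⟦_⟧ : {P : Set} → Dec P → ℕ
⟦ yes _ ⟧ = 1
⟦ no _ ⟧  = 0

⟦⟧-yes : {P : Set} (d : Dec P) → P → ⟦ d ⟧ ≡ 1
⟦⟧-yes (yes _) _ = refl
⟦⟧-yes (no ¬p) p = ⊥-elim (¬p p)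

⟦⟧-no : {P : Set} (d : Dec P) → ¬ P → ⟦ d ⟧ ≡ 0
⟦⟧-no (yes p) ¬p = ⊥-elim (¬p p)
⟦⟧-no (no _)  _  = refl

#subsets : ∀ {n} {P : Pred (Subset n) 0ℓ} → Decidable P → ℕ
#subsets {n} P? = length (filter P? (allSubsets n))

filter-map : {A B : Set} {P : Pred B 0ℓ} (P? : Decidable P) (g : A → B) (xs : List A) →
  filter P? (map g xs) ≡ map g (filter (P? ∘ g) xs)
filter-map P? g [] = refl
filter-map P? g (x ∷ xs) with does (P? (g x))
... | true  = cong (g x ∷_) (filter-map P? g xs)
... | false = filter-map P? g xs

#subsets-step : ∀ {n} {P : Pred (Subset (suc n)) 0ℓ} (P? : Decidable P) →
  #subsets P? ≡ #subsets (P? ∘ (inside ∷_)) + #subsets (P? ∘ (outside ∷_))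
#subsets-step {n} P? = begin
  length (filter P? (map (inside ∷_) A ++ map (outside ∷_) A))
    ≡⟨ cong length (filter-++ P? (map (inside ∷_) A) (map (outside ∷_) A)) ⟩
  length (filter P? (map (inside ∷_) A) ++ filter P? (map (outside ∷_) A))
    ≡⟨ length-++ (filter P? (map (inside ∷_) A)) ⟩
  length (filter P? (map (inside ∷_) A)) + length (filter P? (map (outside ∷_) A))
    ≡⟨ cong₂ _+_ (length-filter-map (inside ∷_)) (length-filter-map (outside ∷_)) ⟩
  #subsets (P? ∘ (inside ∷_)) + #subsets (P? ∘ (outside ∷_)) ∎
  where
  A : List (Subset n)
  A = allSubsets n
  length-filter-map : (g : Subset n → Subset (suc n)) →
    length (filter P? (map g A)) ≡ length (filter (P? ∘ g) A)
  length-filter-map g = trans (cong length (filter-map P? g A)) (length-map g (filter (P? ∘ g) A))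

#subsets-cong : ∀ {n} {P Q : Pred (Subset n) 0ℓ} (P? : Decidable P) (Q? : Decidable Q) →
  P ≐ Q → #subsets P? ≡ #subsets Q?
#subsets-cong P? Q? P≐Q = cong length (filter-≐ P? Q? P≐Q (allSubsets _))

#subsets-none : ∀ {n} {P : Pred (Subset n) 0ℓ} (P? : Decidable P) →
  (∀ S → ¬ P S) → #subsets P? ≡ 0
#subsets-none P? ¬P = cong length (filter-none P? (universal ¬P (allSubsets _)))

Colourful : ∀ {n} → (ℕ → Bool) → (Fin n → ℕ) → Subset n → Set
Colourful F c S =
  (∀ u v → u ∈ S → v ∈ S → u ≢ v → c u ≢ c v) × (∀ u → u ∈ S → F (c u) ≡ false)

colourful? : ∀ {n} (F : ℕ → Bool) (c : Fin n → ℕ) → Decidable (Colourful F c)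
colourful? F c S =
  (all? λ u → all? λ v → u ∈? S →-dec (v ∈? S →-dec (¬? (u ≟ᶠ v) →-dec ¬? (c u ≟ c v))))
  ×-dec (all? λ u → u ∈? S →-dec (F (c u) ≟ᵇ false))

#colourful : ∀ n → (ℕ → Bool) → (Fin n → ℕ) → ℕ
#colourful n F c = #subsets (colourful? {n} F c)

forbid : ℕ → (ℕ → Bool) → ℕ → Bool
forbid l F x with x ≟ l
... | yes _ = true
... | no _  = F x

forbid-self : ∀ l F → forbid l F l ≡ true
forbid-self l F with l ≟ l
... | yes _ = refl
... | no l≢l = ⊥-elim (l≢l refl)

forbid-other : ∀ {l x} F → x ≢ l → forbid l F x ≡ F x
forbid-other {l} {x} F x≢l with x ≟ l
... | yes x≡l = ⊥-elim (x≢l x≡l)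
... | no _    = refl

allowed⇒≢ : ∀ {l x} F → forbid l F x ≡ false → x ≢ l
allowed⇒≢ {l} {x} F allowed with x ≟ l
allowed⇒≢ F () | yes _
... | no x≢l = x≢l

tail-injective : ∀ {n} {b} {S : Subset n} (c : Fin (suc n) → ℕ) →
  (∀ u v → u ∈ b ∷ S → v ∈ b ∷ S → u ≢ v → c u ≢ c v) →
  ∀ u v → u ∈ S → v ∈ S → u ≢ v → c (fs u) ≢ c (fs v)
tail-injective c inj u v u∈S v∈S u≢v = inj (fs u) (fs v) (there u∈S) (there v∈S) (u≢v ∘ fs-injective)

colourful-outside : ∀ {n} F (c : Fin (suc n) → ℕ) →
  (λ S → Colourful F c (outside ∷ S)) ≐ Colourful F (c ∘ fs)
colourful-outside F c = to , from
  where
  to : ∀ {S} → Colourful F c (outside ∷ S) → Colourful F (c ∘ fs) S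
  to (inj , avoid) = tail-injective c inj , λ u u∈S → avoid (fs u) (there u∈S)
  from : ∀ {S} → Colourful F (c ∘ fs) S → Colourful F c (outside ∷ S)
  from (inj , avoid) = inj′ , avoid′
    where
    inj′ : ∀ u v → u ∈ outside ∷ _ → v ∈ outside ∷ _ → u ≢ v → c u ≢ c v
    inj′ (fs u) (fs v) (there u∈S) (there v∈S) u≢v = inj u v u∈S v∈S (u≢v ∘ cong fs)
    avoid′ : ∀ u → u ∈ outside ∷ _ → F (c u) ≡ false
    avoid′ (fs u) (there u∈S) = avoid u u∈S

colourful-inside-forbidden : ∀ {n} F (c : Fin (suc n) → ℕ) → F (c fz) ≡ true →
  ∀ S → ¬ Colourful F c (inside ∷ S)
colourful-inside-forbidden F c forbidden S (_ , avoid) with trans (sym forbidden) (avoid fz here)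
... | ()

colourful-inside : ∀ {n} F (c : Fin (suc n) → ℕ) → F (c fz) ≡ false →
  (λ S → Colourful F c (inside ∷ S)) ≐ Colourful (forbid (c fz) F) (c ∘ fs)
colourful-inside F c free = to , from
  where
  l : ℕ
  l = c fz
  to : ∀ {S} → Colourful F c (inside ∷ S) → Colourful (forbid l F) (c ∘ fs) S
  to (inj , avoid) = tail-injective c inj , avoid′
    where
    avoid′ : ∀ u → u ∈ _ → forbid l F (c (fs u)) ≡ false
    avoid′ u u∈S with c (fs u) ≟ l
    ... | yes same = ⊥-elim (inj (fs u) fz (there u∈S) here (λ ()) same)
    ... | no _     = avoid (fs u) (there u∈S)
  from : ∀ {S} → Colourful (forbid l F) (c ∘ fs) S → Colourful F c (inside ∷ S)
  from (inj , avoid) = inj′ , avoid′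
    where
    inj′ : ∀ u v → u ∈ inside ∷ _ → v ∈ inside ∷ _ → u ≢ v → c u ≢ c v
    inj′ fz     fz     _           _           u≢v _    = u≢v refl
    inj′ fz     (fs v) _           (there v∈S) _   same = allowed⇒≢ F (avoid v v∈S) (sym same)
    inj′ (fs u) fz     (there u∈S) _           _   same = allowed⇒≢ F (avoid u u∈S) same
    inj′ (fs u) (fs v) (there u∈S) (there v∈S) u≢v      = inj u v u∈S v∈S (u≢v ∘ cong fs)
    avoid′ : ∀ u → u ∈ inside ∷ _ → F (c u) ≡ false
    avoid′ fz     here        = free
    avoid′ (fs u) (there u∈S) =
      trans (sym (forbid-other F (allowed⇒≢ F (avoid u u∈S)))) (avoid u u∈S)

#colourful-forbidden : ∀ n F (c : Fin (suc n) → ℕ) → F (c fz) ≡ true →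
  #colourful (suc n) F c ≡ #colourful n F (c ∘ fs)
#colourful-forbidden n F c forbidden = begin
  #colourful (suc n) F c
    ≡⟨ #subsets-step (colourful? F c) ⟩
  #subsets (colourful? F c ∘ (inside ∷_)) + #subsets (colourful? F c ∘ (outside ∷_))
    ≡⟨ cong₂ _+_ (#subsets-none _ (colourful-inside-forbidden F c forbidden))
                 (#subsets-cong _ _ (colourful-outside F c)) ⟩
  #colourful n F (c ∘ fs) ∎

#colourful-free : ∀ n F (c : Fin (suc n) → ℕ) → F (c fz) ≡ false →
  #colourful (suc n) F c ≡ #colourful n (forbid (c fz) F) (c ∘ fs) + #colourful n F (c ∘ fs)
#colourful-free n F c free = begin
  #colourful (suc n) F c
    ≡⟨ #subsets-step (colourful? F c) ⟩
  #subsets (colourful? F c ∘ (inside ∷_)) + #subsets (colourful? F c ∘ (outside ∷_))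
    ≡⟨ cong₂ _+_ (#subsets-cong _ _ (colourful-inside F c free))
                 (#subsets-cong _ _ (colourful-outside F c)) ⟩
  #colourful n (forbid (c fz) F) (c ∘ fs) + #colourful n F (c ∘ fs) ∎

∏ : ℕ → (ℕ → ℕ) → ℕ
∏ zero    g = 1
∏ (suc a) g = g a * ∏ a g

∏-cong : ∀ a {g h : ℕ → ℕ} → (∀ x → x < a → g x ≡ h x) → ∏ a g ≡ ∏ a h
∏-cong zero    g≗h = refl
∏-cong (suc a) g≗h = cong₂ _*_ (g≗h a ≤-refl) (∏-cong a (λ x x<a → g≗h x (m<n⇒m<1+n x<a)))

∏-ones : ∀ a {g : ℕ → ℕ} → (∀ x → g x ≡ 1) → ∏ a g ≡ 1
∏-ones zero    g≗1 = refl
∏-ones (suc a) g≗1 rewrite g≗1 a | ∏-ones a g≗1 = refl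

∏-split : ∀ a l (g g₁ g₂ : ℕ → ℕ) → l < a →
  (∀ x → x ≢ l → g x ≡ g₁ x) → (∀ x → x ≢ l → g x ≡ g₂ x) → g l ≡ g₁ l + g₂ l →
  ∏ a g ≡ ∏ a g₁ + ∏ a g₂
∏-split (suc a) l g g₁ g₂ l<1+a g≗g₁ g≗g₂ split with a ≟ l
... | yes refl = begin
  g a * ∏ a g                       ≡⟨ cong (_* ∏ a g) split ⟩
  (g₁ a + g₂ a) * ∏ a g             ≡⟨ *-distribʳ-+ (∏ a g) (g₁ a) (g₂ a) ⟩
  g₁ a * ∏ a g + g₂ a * ∏ a g       ≡⟨ cong₂ _+_ (cong (g₁ a *_) (∏-cong a (λ x x<a → g≗g₁ x (<⇒≢ x<a))))
                                                 (cong (g₂ a *_) (∏-cong a (λ x x<a → g≗g₂ x (<⇒≢ x<a)))) ⟩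
  g₁ a * ∏ a g₁ + g₂ a * ∏ a g₂     ∎
... | no a≢l = begin
  g a * ∏ a g                       ≡⟨ cong (g a *_) (∏-split a l g g₁ g₂ l<a g≗g₁ g≗g₂ split) ⟩
  g a * (∏ a g₁ + ∏ a g₂)           ≡⟨ *-distribˡ-+ (g a) (∏ a g₁) (∏ a g₂) ⟩
  g a * ∏ a g₁ + g a * ∏ a g₂       ≡⟨ cong₂ _+_ (cong (_* ∏ a g₁) (g≗g₁ a a≢l)) (cong (_* ∏ a g₂) (g≗g₂ a a≢l)) ⟩
  g₁ a * ∏ a g₁ + g₂ a * ∏ a g₂     ∎
  where
  l<a : l < a
  l<a = ≤∧≢⇒< (≤-pred l<1+a) (a≢l ∘ sym)

classSize : ∀ {n} → ℕ → (Fin n → ℕ) → ℕ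
classSize {zero}  x c = 0
classSize {suc n} x c = ⟦ c fz ≟ x ⟧ + classSize x (c ∘ fs)

-- The factor contributed by a colour class of the given size: a forbidden
-- class contributes only the choice "no vertex", a free one also each vertex.
weight : Bool → ℕ → ℕ
weight true  _ = 1
weight false m = suc m

colourful-product : ∀ α n F (c : Fin n → ℕ) → (∀ v → c v < α) →
  #colourful n F c ≡ ∏ α (λ x → weight (F x) (classSize x c))
colourful-product α zero F c _ = sym (∏-ones α (λ x → weight-empty (F x)))
  where
  weight-empty : ∀ b → weight b 0 ≡ 1
  weight-empty true  = refl
  weight-empty false = refl
colourful-product α (suc n) F c c<α = by-colour-of-0 (F l) refl
  where
  l : ℕ
  l = c fz
  c′ : Fin n → ℕ
  c′ = c ∘ fs
  goal : Set
  goal = #colourful (suc n) F c ≡ ∏ α (λ x → weight (F x) (classSize x c))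
  by-colour-of-0 : ∀ b → F l ≡ b → goal
  by-colour-of-0 true forbidden = begin
    #colourful (suc n) F c
      ≡⟨ #colourful-forbidden n F c forbidden ⟩
    #colourful n F c′
      ≡⟨ colourful-product α n F c′ (c<α ∘ fs) ⟩
    ∏ α (λ x → weight (F x) (classSize x c′))
      ≡⟨ ∏-cong α (λ x _ → class-of-0-irrelevant x) ⟩
    ∏ α (λ x → weight (F x) (classSize x c)) ∎
    where
    -- the class of the forbidden colour l has weight 1 whatever its size
    class-of-0-irrelevant : ∀ x → weight (F x) (classSize x c′) ≡ weight (F x) (classSize x c)
    class-of-0-irrelevant x with l ≟ x
    ... | yes refl rewrite forbidden = refl
    ... | no _ = refl
  by-colour-of-0 false free = begin
    #colourful (suc n) F c
      ≡⟨ #colourful-free n F c free ⟩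
    #colourful n (forbid l F) c′ + #colourful n F c′
      ≡⟨ cong₂ _+_ (colourful-product α n (forbid l F) c′ (c<α ∘ fs)) (colourful-product α n F c′ (c<α ∘ fs)) ⟩
    ∏ α (λ x → weight (forbid l F x) (classSize x c′)) + ∏ α (λ x → weight (F x) (classSize x c′))
      ≡⟨ sym (∏-split α l _ _ _ (c<α fz) away-from-l away-from-l′ at-l) ⟩
    ∏ α (λ x → weight (F x) (classSize x c)) ∎
    where
    -- away from l the class sizes of c and c′ agree and forbidding l changes
    -- nothing; at l the weight 2 + c′_l splits as 1 + (1 + c′_l)
    away-from-l : ∀ x → x ≢ l → weight (F x) (classSize x c) ≡ weight (forbid l F x) (classSize x c′)
    away-from-l x x≢l rewrite ⟦⟧-no (l ≟ x) (x≢l ∘ sym) | forbid-other F x≢l = refl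
    away-from-l′ : ∀ x → x ≢ l → weight (F x) (classSize x c) ≡ weight (F x) (classSize x c′)
    away-from-l′ x x≢l rewrite ⟦⟧-no (l ≟ x) (x≢l ∘ sym) = refl
    at-l : weight (F l) (classSize l c) ≡ weight (forbid l F l) (classSize l c′) + weight (F l) (classSize l c′)
    at-l rewrite ⟦⟧-yes (l ≟ l) refl | forbid-self l F | free = refl

stable⇔colourful : ∀ n α →
  IsStable n α ≐ Colourful (λ _ → false) (λ v → cliqueOf α (toℕ v))
stable⇔colourful n α = to , from
  where
  to : ∀ {S} → IsStable n α S → Colourful (λ _ → false) (λ v → cliqueOf α (toℕ v)) S
  to stable = (λ u v u∈S v∈S u≢v same → stable u v u∈S v∈S (u≢v , same)) , (λ _ _ → refl)
  from : ∀ {S} → Colourful (λ _ → false) (λ v → cliqueOf α (toℕ v)) S → IsStable n α S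
  from (inj , _) u v u∈S v∈S (u≢v , same) = inj u v u∈S v∈S u≢v same

fT-product : ∀ n k →
  fT n (suc k) ≡ ∏ (suc k) (λ x → suc (classSize x (λ (v : Fin n) → toℕ v % suc k)))
fT-product n k = trans (#subsets-cong (stable? n (suc k)) _ (stable⇔colourful n (suc k)))
  (colourful-product (suc k) n (λ _ → false) _ (λ v → m%n<n (toℕ v) (suc k)))

classSize-snoc : ∀ m x (g : ℕ → ℕ) →
  classSize x (λ (v : Fin (suc m)) → g (toℕ v)) ≡ classSize x (λ (v : Fin m) → g (toℕ v)) + ⟦ g m ≟ x ⟧
classSize-snoc zero    x g = +-comm ⟦ g 0 ≟ x ⟧ 0
classSize-snoc (suc m) x g = begin
  ⟦ g 0 ≟ x ⟧ + classSize x (λ (v : Fin (suc m)) → g (suc (toℕ v)))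
    ≡⟨ cong (⟦ g 0 ≟ x ⟧ +_) (classSize-snoc m x (g ∘ suc)) ⟩
  ⟦ g 0 ≟ x ⟧ + (classSize x (λ (v : Fin m) → g (suc (toℕ v))) + ⟦ g (suc m) ≟ x ⟧)
    ≡⟨ sym (+-assoc ⟦ g 0 ≟ x ⟧ _ _) ⟩
  ⟦ g 0 ≟ x ⟧ + classSize x (λ (v : Fin m) → g (suc (toℕ v))) + ⟦ g (suc m) ≟ x ⟧ ∎

⟦<?⟧-suc : ∀ x r → ⟦ x <? suc r ⟧ ≡ ⟦ x <? r ⟧ + ⟦ r ≟ x ⟧
⟦<?⟧-suc x r with <-cmp x r
... | tri< x<r x≢r _
  rewrite ⟦⟧-yes (x <? suc r) (m<n⇒m<1+n x<r) | ⟦⟧-yes (x <? r) x<r | ⟦⟧-no (r ≟ x) (x≢r ∘ sym) = refl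
... | tri≈ _ refl _
  rewrite ⟦⟧-yes (x <? suc x) (n<1+n x) | ⟦⟧-no (x <? x) (n≮n x) | ⟦⟧-yes (x ≟ x) refl = refl
... | tri> _ x≢r r<x
  rewrite ⟦⟧-no (x <? suc r) (<⇒≱ r<x ∘ ≤-pred) | ⟦⟧-no (x <? r) (<⇒≯ r<x) | ⟦⟧-no (r ≟ x) (x≢r ∘ sym) = refl

module ResidueClasses (k : ℕ) where
  α : ℕ
  α = suc k

  residueCount : ℕ → ℕ → ℕ
  residueCount x m = classSize x (λ (v : Fin m) → toℕ v % α)

  partial-block : ∀ x q → residueCount x (q * α) ≡ q →
    ∀ r → r ≤ α → residueCount x (r + q * α) ≡ q + ⟦ x <? r ⟧
  partial-block x q full zero _ = trans full (sym (+-identityʳ q))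
  partial-block x q full (suc r) r<α = begin
    residueCount x (suc (r + q * α))
      ≡⟨ classSize-snoc (r + q * α) x (_% α) ⟩
    residueCount x (r + q * α) + ⟦ (r + q * α) % α ≟ x ⟧
      ≡⟨ cong₂ _+_ (partial-block x q full r (<⇒≤ r<α)) (cong (λ y → ⟦ y ≟ x ⟧) residue) ⟩
    q + ⟦ x <? r ⟧ + ⟦ r ≟ x ⟧
      ≡⟨ +-assoc q _ _ ⟩
    q + (⟦ x <? r ⟧ + ⟦ r ≟ x ⟧)
      ≡⟨ cong (q +_) (sym (⟦<?⟧-suc x r)) ⟩
    q + ⟦ x <? suc r ⟧ ∎
    where
    residue : (r + q * α) % α ≡ r
    residue = trans ([m+kn]%n≡m%n r q α) (m<n⇒m%n≡m r<α)

  -- each full period 0, …, α - 1 contributes one element to every class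
  full-blocks : ∀ x → x < α → ∀ q → residueCount x (q * α) ≡ q
  full-blocks x x<α zero    = refl
  full-blocks x x<α (suc q) = begin
    residueCount x (α + q * α)   ≡⟨ partial-block x q (full-blocks x x<α q) α ≤-refl ⟩
    q + ⟦ x <? α ⟧               ≡⟨ cong (q +_) (⟦⟧-yes (x <? α) x<α) ⟩
    q + 1                        ≡⟨ +-comm q 1 ⟩
    suc q                        ∎

  residue-classSize : ∀ x → x < α → ∀ q r → r ≤ α → residueCount x (r + q * α) ≡ q + ⟦ x <? r ⟧
  residue-classSize x x<α q = partial-block x q (full-blocks x x<α q)

open ResidueClasses using (residue-classSize)

∏-threshold : ∀ b r d → ∏ (r + d) (λ x → b + ⟦ x <? r ⟧) ≡ suc b ^ r * b ^ d
∏-threshold b r zero = begin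
  ∏ (r + 0) (λ x → b + ⟦ x <? r ⟧)   ≡⟨ cong (λ a → ∏ a (λ x → b + ⟦ x <? r ⟧)) (+-identityʳ r) ⟩
  ∏ r (λ x → b + ⟦ x <? r ⟧)         ≡⟨ below r ≤-refl ⟩
  suc b ^ r                          ≡⟨ sym (*-identityʳ (suc b ^ r)) ⟩
  suc b ^ r * 1                      ∎
  where
  below : ∀ a → a ≤ r → ∏ a (λ x → b + ⟦ x <? r ⟧) ≡ suc b ^ a
  below zero    _     = refl
  below (suc a) a<r = cong₂ _*_ (trans (cong (b +_) (⟦⟧-yes (a <? r) a<r)) (+-comm b 1)) (below a (<⇒≤ a<r))
∏-threshold b r (suc d) = begin
  ∏ (r + suc d) (λ x → b + ⟦ x <? r ⟧)
    ≡⟨ cong (λ a → ∏ a (λ x → b + ⟦ x <? r ⟧)) (+-suc r d) ⟩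
  (b + ⟦ r + d <? r ⟧) * ∏ (r + d) (λ x → b + ⟦ x <? r ⟧)
    ≡⟨ cong₂ _*_ (trans (cong (b +_) (⟦⟧-no (r + d <? r) (m+n≮m r d))) (+-identityʳ b)) (∏-threshold b r d) ⟩
  b * (suc b ^ r * b ^ d)
    ≡⟨ solve 3 (λ b B D → b :* (B :* D) := B :* (b :* D)) refl b (suc b ^ r) (b ^ d) ⟩
  suc b ^ r * (b * b ^ d) ∎

fT-closed-form : ∀ k q r → r ≤ suc k →
  fT (r + q * suc k) (suc k) ≡ (2 + q) ^ r * (1 + q) ^ (suc k ∸ r)
fT-closed-form k q r r≤α = begin
  fT (r + q * α) α
    ≡⟨ fT-product (r + q * α) k ⟩
  ∏ α (λ x → suc (classSize x (λ (v : Fin (r + q * α)) → toℕ v % α)))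
    ≡⟨ ∏-cong α (λ x x<α → cong suc (residue-classSize k x x<α q r r≤α)) ⟩
  ∏ α (λ x → suc q + ⟦ x <? r ⟧)
    ≡⟨ cong (λ a → ∏ a (λ x → suc q + ⟦ x <? r ⟧)) (sym (m+[n∸m]≡n r≤α)) ⟩
  ∏ (r + (α ∸ r)) (λ x → suc q + ⟦ x <? r ⟧)
    ≡⟨ ∏-threshold (suc q) r (α ∸ r) ⟩
  (2 + q) ^ r * (1 + q) ^ (α ∸ r) ∎
  where
  α : ℕ
  α = suc k

fT-one-clique : ∀ n → fT n 1 ≡ n + 1
fT-one-clique n = begin
  fT n 1               ≡⟨ cong (λ m → fT m 1) (sym (*-identityʳ n)) ⟩
  fT (0 + n * 1) 1     ≡⟨ fT-closed-form 0 n 0 z≤n ⟩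
  1 * ((1 + n) * 1)    ≡⟨ solve 1 (λ n → con 1 :* ((con 1 :+ n) :* con 1) := n :+ con 1) refl n ⟩
  n + 1                ∎

fT-discrete : ∀ n → 1 ≤ n → fT n n ≡ 2 ^ n
fT-discrete (suc k) _ = begin
  fT (suc k) (suc k)                       ≡⟨ cong (λ m → fT m (suc k)) (sym (+-identityʳ (suc k))) ⟩
  fT (suc k + 0 * suc k) (suc k)           ≡⟨ fT-closed-form k 0 (suc k) ≤-refl ⟩
  2 ^ suc k * 1 ^ (suc k ∸ suc k)          ≡⟨ cong (λ e → 2 ^ suc k * 1 ^ e) (n∸n≡0 (suc k)) ⟩
  2 ^ suc k * 1                            ≡⟨ *-identityʳ (2 ^ suc k) ⟩
  2 ^ suc k                                ∎

ceilDiv-block : ∀ k q r → r < suc k → ceilDiv (suc r + q * suc k) (suc k) ≡ suc q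
ceilDiv-block k q r r<α = begin
  (suc r + q * α + k) / α       ≡⟨ cong (_/ α) (solve 3 (λ r q k → con 1 :+ r :+ q :* (con 1 :+ k) :+ k
                                                         := r :+ (con 1 :+ q) :* (con 1 :+ k)) refl r q k) ⟩
  (r + suc q * α) / α           ≡⟨ +-distrib-/-∣ʳ r (n∣m*n (suc q)) ⟩
  r / α + suc q * α / α         ≡⟨ cong₂ _+_ (m<n⇒m/n≡0 r<α) (m*n/n≡m (suc q) α) ⟩
  suc q                         ∎
  where
  α : ℕ
  α = suc k

-- The recurrence for n = (r + 1) + qα, r < α, α ≥ 2: both sides are instances
-- of the closed form, and (q+2)^{r+1} = (q+2)^r (q+1) + (q+2)^r.
fT-recurrence-block : ∀ k q r → r ≤ suc k →
  let α = suc (suc k) ; n = suc r + q * α in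
  fT n α ≡ fT (n ∸ 1) α + fT (n ∸ ceilDiv n α) (α ∸ 1)
fT-recurrence-block k q r r≤1+k = begin
  fT (suc r + q * α) α
    ≡⟨ fT-closed-form (suc k) q (suc r) (s≤s r≤1+k) ⟩
  (2 + q) ^ suc r * (1 + q) ^ (suc k ∸ r)
    ≡⟨ solve 3 (λ q X Y → ((con 2 :+ q) :* X) :* Y := X :* ((con 1 :+ q) :* Y) :+ X :* Y) refl q ((2 + q) ^ r) ((1 + q) ^ (suc k ∸ r)) ⟩
  (2 + q) ^ r * (1 + q) ^ suc (suc k ∸ r) + (2 + q) ^ r * (1 + q) ^ (suc k ∸ r)
    ≡⟨ cong (λ e → (2 + q) ^ r * (1 + q) ^ e + (2 + q) ^ r * (1 + q) ^ (suc k ∸ r)) (sym (+-∸-assoc 1 r≤1+k)) ⟩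
  (2 + q) ^ r * (1 + q) ^ (α ∸ r) + (2 + q) ^ r * (1 + q) ^ (suc k ∸ r)
    ≡⟨ cong₂ _+_ (sym (fT-closed-form (suc k) q r (m≤n⇒m≤1+n r≤1+k))) (sym (fT-closed-form k q r r≤1+k)) ⟩
  fT (r + q * α) α + fT (r + q * suc k) (suc k)
    ≡⟨ cong (λ m → fT (r + q * α) α + fT m (suc k)) (sym rest) ⟩
  fT (r + q * α) α + fT (suc r + q * α ∸ ceilDiv (suc r + q * α) α) (suc k) ∎
  where
  α : ℕ
  α = suc (suc k)
  rest : suc r + q * α ∸ ceilDiv (suc r + q * α) α ≡ r + q * suc k
  rest = begin
    suc r + q * α ∸ ceilDiv (suc r + q * α) α ≡⟨ cong (suc r + q * α ∸_) (ceilDiv-block (suc k) q r (s≤s r≤1+k)) ⟩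
    suc r + q * α ∸ suc q                     ≡⟨ cong (_∸ suc q) (solve 3 (λ r q k → con 1 :+ r :+ q :* (con 2 :+ k)
                                                    := r :+ q :* (con 1 :+ k) :+ (con 1 :+ q)) refl r q k) ⟩
    r + q * suc k + suc q ∸ suc q             ≡⟨ m+n∸n≡m (r + q * suc k) (suc q) ⟩
    r + q * suc k                             ∎

-- The recurrence for all 2 ≤ α ≤ n, writing n - 1 = (n - 1) mod α + ⌊(n-1)/α⌋ α.
fT-recurrence : ∀ n α → 2 ≤ α → α ≤ n →
  fT n α ≡ fT (n ∸ 1) α + fT (n ∸ ceilDiv n α) (α ∸ 1)
fT-recurrence (suc m) (suc zero) (s≤s ()) _
fT-recurrence (suc m) (suc (suc k)) _ _ =
  subst (λ n → fT n α ≡ fT (n ∸ 1) α + fT (n ∸ ceilDiv n α) (α ∸ 1))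
        (cong suc (sym (m≡m%n+[m/n]*n m α)))
        (fT-recurrence-block k (m / α) (m % α) (≤-pred (m%n<n m α)))
  where
  α : ℕ
  α = suc (suc k)

lemma5 : (n α : ℕ) → 1 ≤ α → α ≤ n →
    (α ≡ 1 → fT n α ≡ n + 1) ×
    (α ≡ n → fT n α ≡ 2 ^ n) ×
    (2 ≤ α → α ≤ n ∸ 1 → fT n α ≡ fT (n ∸ 1) α + fT (n ∸ ceilDiv n α) (α ∸ 1))
lemma5 n α 1≤α α≤n =
  (λ { refl → fT-one-clique n }) ,
  (λ { refl → fT-discrete n 1≤α }) ,
  (λ 2≤α _ → fT-recurrence n α 2≤α α≤n)
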